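{- Let $\mathcal{I}=(\mathcal{N},W)$ be an instance, let $\mathcal{S}$ be a feasible chain for $\mathcal{I}$, let $G\subseteq\mathcal{N}$, and let $\mathcal{G}=\mathcal{S}|_G$. Then $\mathcal{S}|_{\mathcal{N}\setminus G}$ is a feasible chain for the residual instance $\mathcal{I}^{ -\mathcal{G}}$ with profit $\Phi(\mathcal{S}|_{\mathcal{N}\setminus G})=\Phi(\mathcal{S})-\Phi(\mathcal{G})$. Moreover, if $\mathcal{S}$ is optimal for $\mathcal{I}$, then $\mathcal{S}|_{\mathcal{N}\setminus G}$ is optimal for $\mathcal{I}^{ -\mathcal{G}}$.
   Context: An instance $\mathcal{I}=(\mathcal{N},W)$ of generalized incremental knapsack consists of an item set $\mathcal{N}$ with strictly positive weights $w_i$, $T$ periods with capacities $W=(W_1,\dots,W_T)$, $W_1\le\cdots\le W_T$, and non-negative profits $p_{it}$ (weights, $T$ and profits are shared by all instances considered). A chain is $\mathcal{S}=(S_1,\dots,S_T)$ with $S_1\subseteq\cdots\subseteq S_T\subseteq\mathcal{N}$; it is feasible if $w(S_t)\le W_t$ for all $t$; its profit is $\Phi(\mathcal{S})=\sum_t\sum_{i\in S_t\setminus S_{t-1}}p_{it}$, $S_0=\emptyset$; it is optimal if it is a feasible chain of maximum profit. The restriction of a chain to $G$ is $\mathcal{S}|_G=(S_1\cap G,\dots,S_T\cap G)$. For a feasible chain $\mathcal{G}=(G_1,\dots,G_T)$ for $\mathcal{I}$, the residual instance $\mathcal{I}^{ -\mathcal{G}}=(\mathcal{N}\setminus G_T,W^{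 -\mathcal{G}})$ has capacities $W^{ -\mathcal{G}}_t=\min_{t\le\tau\le T}(W_\tau-w(G_\tau))$, with the same weights and profits.
   Formalization: The weights $w_i$, the capacities $W_t$ and the profits $p_{it}$ take values in the rationals. -}

module Defs where

open import Data.Nat using (ℕ; zero; suc)
open import Data.Bool using (Bool; true; false; if_then_else_)
open import Data.Fin using (Fin; zero; suc; inject₁)
open import Data.Fin.Subset using (Subset; _∩_; _─_; ⊥; _⊆_; ∁; _∈_)
open import Data.Vec using (lookup)
open import Data.Rational using (ℚ; 0ℚ; _+_; _-_; _⊓_; _≤_; _<_)
open import Data.Product using (_×_)

-- Items of the ground universe are Fin n; periods are Fin T (period 1 = zero).
-- Weights, capacities and profits are rational numbers.

sumF : ∀ {n} → (Fin n → ℚ) → ℚ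
sumF {zero} f = 0ℚ
sumF {suc n} f = f zero + sumF (λ i → f (suc i))

weight : ∀ {n} → (Fin n → ℚ) → Subset n → ℚ
weight w S = sumF (λ i → if lookup S i then w i else 0ℚ)

Chain : ℕ → ℕ → Set
Chain n T = Fin T → Subset n

IsChain : ∀ {n T} → Chain n T → Set
IsChain {T = T} S = (s t : Fin T) → s Data.Fin.≤ t → S s ⊆ S t
  where import Data.Fin

MonotoneCap : ∀ {T} → (Fin T → ℚ) → Set
MonotoneCap {T} W = (s t : Fin T) → s Data.Fin.≤ t → W s ≤ W t
  where import Data.Fin

record Instance (n T : ℕ) : Set where
  constructor inst
  field
    items : Subset n
    cap   : Fin T → ℚ

open Instance public

Feasible : ∀ {n T} → (Fin n → ℚ) → Instance n T → Chain n T → Set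
Feasible {T = T} w I S =
  IsChain S
  × ((t : Fin T) → S t ⊆ items I)
  × ((t : Fin T) → weight w (S t) ≤ cap I t)

prev : ∀ {n T} → Chain n T → Fin T → Subset n
prev S zero = ⊥
prev S (suc t) = S (inject₁ t)

profit : ∀ {n T} → (Fin n → Fin T → ℚ) → Chain n T → ℚ
profit p S = sumF (λ t → sumF (λ i → if lookup (S t ─ prev S t) i then p i t else 0ℚ))

Optimal : ∀ {n T} → (Fin n → ℚ) → (Fin n → Fin T → ℚ) → Instance n T → Chain n T → Set
Optimal w p I S = Feasible w I S × ((S' : Chain _ _) → Feasible w I S' → profit p S' ≤ profit p S)

restrict : ∀ {n T} → Chain n T → Subset n → Chain n T
restrict S G t = S t ∩ G

sufMin : ∀ {T} → (Fin T → ℚ) → Fin T → ℚ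
sufMin {suc zero} f zero = f zero
sufMin {suc (suc m)} f zero = f zero ⊓ sufMin (λ τ → f (suc τ)) zero
sufMin {suc m} f (suc t) = sufMin (λ τ → f (suc τ)) t

-- residual instance I^{-𝒢} = (𝒩 \ G_T, W^{-𝒢}),  W^{-𝒢}_t = min_{τ ≥ t} (W_τ - w(G_τ))
-- (for T = 0 the item set is irrelevant: no periods; we keep 𝒩)
lastSet : ∀ {n T} → Chain n T → Subset n → Subset n
lastSet {T = zero} G N = N
lastSet {T = suc m} G N = N ─ G (Data.Fin.fromℕ m)
  where import Data.Fin

residual : ∀ {n T} → (Fin n → ℚ) → Instance n T → Chain n T → Instance n T
residual w I G = inst (lastSet G (items I)) (sufMin (λ τ → cap I τ - weight w (G τ)))

-- The restrictions of S to ∁G and to G split every weight w(S_t) and the profit Φ(S) additively.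
-- Since S|∁G grows with t, for every τ ≥ t it weighs at most w(S_τ) − w(G_τ) ≤ W_τ − w(G_τ), so it
-- fits the residual capacities. Conversely a feasible chain S′ of the residual instance avoids
-- G_T ⊇ G_t, so S′ ∪ 𝒢 is feasible for the original instance with profit Φ(S′) + Φ(𝒢) ≤ Φ(S);
-- subtracting Φ(𝒢) gives optimality of S|∁G.
module Submission where

open import Defs
open import Data.Nat using (ℕ)
open import Data.Fin using (Fin)
open import Data.Fin.Subset using (Subset; _⊆_; ∁)
open import Data.Rational using (ℚ; 0ℚ; _-_; _≤_; _<_)
open import Data.Product using (_×_)
open import Relation.Binary.PropositionalEquality using (_≡_)

open import Data.Nat using (zero; suc; z≤n; s≤s)
open import Data.Fin as F using (zero; suc; inject₁; fromℕ)
import Data.Fin.Properties as Finₚ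
open import Data.Fin.Properties using (≤fromℕ; i≤inject₁[j]⇒i≤1+j)
open import Data.Fin.Subset using (⊥; _∩_; _∪_; _─_; _∈_; _∉_; inside; outside)
open import Data.Fin.Subset.Properties
  using (_∈?_; p∩q⊆p; p∩q⊆q; x∈p∩q⁺; x∈p∩q⁻; x∈p∪q⁺; x∈p∪q⁻; p⊆p∪q; q⊆p∪q;
         x∈∁p⇒x∉p; x∉p⇒x∈∁p; x∈p∧x∉q⇒x∈p─q; p─q⊆p; ⊆-antisym; ∪-identityʳ; ⊥⊆)
open import Data.Bool using (true; false; _∨_; if_then_else_)
open import Data.Vec using (_∷_; lookup; here; there)
open import Data.Vec.Properties using (lookup-zipWith; lookup⇒[]=; []=⇒lookup)
open import Data.Rational using (_+_; -_)
open import Data.Rational.Properties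
  using (≤-refl; ≤-trans; <⇒≤; +-mono-≤; +-monoˡ-≤; +-identityˡ; +-identityʳ; +-0-group; +-0-commutativeMonoid;
         p⊓q≤p; ⊓-glb; module ≤-Reasoning)
open import Algebra.Bundles using (CommutativeMonoid)
open import Algebra.Properties.CommutativeSemigroup
  (CommutativeMonoid.commutativeSemigroup +-0-commutativeMonoid) using (interchange)
open import Algebra.Properties.Group +-0-group using (//-rightDividesˡ; //-rightDividesʳ)
open import Data.Product using (_,_; proj₁; proj₂)
open import Data.Sum as Sum using (inj₁; inj₂)
open import Data.Empty using (⊥-elim)
open import Function using (_∘_)
open import Relation.Nullary using (yes; no)
open import Relation.Binary.PropositionalEquality using (module ≡-Reasoning; refl; sym; trans; cong; cong₂; subst₂)

sumF-cong : ∀ {n} {f g : Fin n → ℚ} → (∀ i → f i ≡ g i) → sumF f ≡ sumF g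
sumF-cong {zero}  f≗g = refl
sumF-cong {suc n} f≗g = cong₂ _+_ (f≗g zero) (sumF-cong (f≗g ∘ suc))

sumF-+ : ∀ {n} (f g : Fin n → ℚ) → sumF (λ i → f i + g i) ≡ sumF f + sumF g
sumF-+ {zero}  f g = sym (+-identityʳ 0ℚ)
sumF-+ {suc n} f g =
  trans (cong (f zero + g zero +_) (sumF-+ (f ∘ suc) (g ∘ suc)))
        (interchange (f zero) (g zero) (sumF (f ∘ suc)) (sumF (g ∘ suc)))

sumF-mono : ∀ {n} {f g : Fin n → ℚ} → (∀ i → f i ≤ g i) → sumF f ≤ sumF g
sumF-mono {zero}  f≤g = ≤-refl
sumF-mono {suc n} f≤g = +-mono-≤ (f≤g zero) (sumF-mono (f≤g ∘ suc))

Disjoint : ∀ {n} → Subset n → Subset n → Set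
Disjoint A B = ∀ {i} → i ∈ A → i ∉ B

x∈p─q⇒x∉q : ∀ {n} {x : Fin n} (p q : Subset n) → x ∈ p ─ q → x ∉ q
x∈p─q⇒x∉q (inside ∷ p) (outside ∷ q) here       ()
x∈p─q⇒x∉q (s ∷ p)      (outside ∷ q) (there x∈) (there x∈q) = x∈p─q⇒x∉q p q x∈ x∈q
x∈p─q⇒x∉q (s ∷ p)      (inside ∷ q)  (there x∈) (there x∈q) = x∈p─q⇒x∉q p q x∈ x∈q

p∩∁q-disjoint-p∩q : ∀ {n} (p q : Subset n) → Disjoint (p ∩ ∁ q) (p ∩ q)
p∩∁q-disjoint-p∩q p q x∈p∩∁q x∈p∩q =
  x∈∁p⇒x∉p (proj₂ (x∈p∩q⁻ p (∁ q) x∈p∩∁q)) (proj₂ (x∈p∩q⁻ p q x∈p∩q))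

p≡p∩∁q∪p∩q : ∀ {n} (p q : Subset n) → p ≡ (p ∩ ∁ q) ∪ (p ∩ q)
p≡p∩∁q∪p∩q p q = ⊆-antisym split join
  where
  split : p ⊆ (p ∩ ∁ q) ∪ (p ∩ q)
  split {x} x∈p with x ∈? q
  ... | yes x∈q = x∈p∪q⁺ (inj₂ (x∈p∩q⁺ (x∈p , x∈q)))
  ... | no  x∉q = x∈p∪q⁺ (inj₁ (x∈p∩q⁺ (x∈p , x∉p⇒x∈∁p x∉q)))
  join : (p ∩ ∁ q) ∪ (p ∩ q) ⊆ p
  join x∈ with x∈p∪q⁻ (p ∩ ∁ q) (p ∩ q) x∈
  ... | inj₁ x∈p∩∁q = p∩q⊆p p (∁ q) x∈p∩∁q
  ... | inj₂ x∈p∩q  = p∩q⊆p p q x∈p∩q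

Disjoint-anti-mono : ∀ {n} {A A′ B B′ : Subset n} → A′ ⊆ A → B′ ⊆ B → Disjoint A B → Disjoint A′ B′
Disjoint-anti-mono A′⊆A B′⊆B A⊥B x∈A′ x∈B′ = A⊥B (A′⊆A x∈A′) (B′⊆B x∈B′)

∪─∪≡─∪─ : ∀ {n} (A A′ B B′ : Subset n) → A′ ⊆ A → B′ ⊆ B → Disjoint A B
        → (A ∪ B) ─ (A′ ∪ B′) ≡ (A ─ A′) ∪ (B ─ B′)
∪─∪≡─∪─ A A′ B B′ A′⊆A B′⊆B A⊥B = ⊆-antisym split join
  where
  split : (A ∪ B) ─ (A′ ∪ B′) ⊆ (A ─ A′) ∪ (B ─ B′)
  split x∈ = x∈p∪q⁺ (Sum.map (λ x∈A → x∈p∧x∉q⇒x∈p─q x∈A (x∉A′∪B′ ∘ p⊆p∪q B′))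
                             (λ x∈B → x∈p∧x∉q⇒x∈p─q x∈B (x∉A′∪B′ ∘ q⊆p∪q A′ B′))
                             (x∈p∪q⁻ A B (p─q⊆p (A ∪ B) (A′ ∪ B′) x∈)))
    where x∉A′∪B′ = x∈p─q⇒x∉q (A ∪ B) (A′ ∪ B′) x∈
  x∉p∪q : ∀ {x} {p q : Subset _} → x ∉ p → x ∉ q → x ∉ p ∪ q
  x∉p∪q {p = p} {q} x∉p x∉q = Sum.[ x∉p , x∉q ] ∘ x∈p∪q⁻ p q
  join : (A ─ A′) ∪ (B ─ B′) ⊆ (A ∪ B) ─ (A′ ∪ B′)
  join x∈ with x∈p∪q⁻ (A ─ A′) (B ─ B′) x∈
  ... | inj₁ x∈A─A′ = x∈p∧x∉q⇒x∈p─q (x∈p∪q⁺ (inj₁ x∈A))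
                        (x∉p∪q (x∈p─q⇒x∉q A A′ x∈A─A′) (A⊥B x∈A ∘ B′⊆B))
    where x∈A = p─q⊆p A A′ x∈A─A′
  ... | inj₂ x∈B─B′ = x∈p∧x∉q⇒x∈p─q (x∈p∪q⁺ (inj₂ x∈B))
                        (x∉p∪q (λ x∈A′ → A⊥B (A′⊆A x∈A′) x∈B) (x∈p─q⇒x∉q B B′ x∈B─B′))
    where x∈B = p─q⊆p B B′ x∈B─B′

weightTerm : ∀ {n} → (Fin n → ℚ) → Subset n → Fin n → ℚ
weightTerm w A i = if lookup A i then w i else 0ℚ

weight-∪ : ∀ {n} (w : Fin n → ℚ) (A B : Subset n) → Disjoint A B
         → weight w (A ∪ B) ≡ weight w A + weight w B
weight-∪ w A B A⊥B = trans (sumF-cong weightTerm-∪) (sumF-+ (weightTerm w A) (weightTerm w B))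
  where
  weightTerm-∪ : ∀ i → weightTerm w (A ∪ B) i ≡ weightTerm w A i + weightTerm w B i
  weightTerm-∪ i rewrite lookup-zipWith _∨_ i A B with lookup A i in i∈A | lookup B i in i∈B
  ... | true  | true  = ⊥-elim (A⊥B (lookup⇒[]= i A i∈A) (lookup⇒[]= i B i∈B))
  ... | true  | false = sym (+-identityʳ (w i))
  ... | false | true  = sym (+-identityˡ (w i))
  ... | false | false = sym (+-identityʳ 0ℚ)

weight-mono : ∀ {n} (w : Fin n → ℚ) → (∀ i → 0ℚ ≤ w i) → {A B : Subset n} → A ⊆ B
            → weight w A ≤ weight w B
weight-mono w w≥0 {A} {B} A⊆B = sumF-mono weightTerm-mono
  where
  weightTerm-mono : ∀ i → weightTerm w A i ≤ weightTerm w B i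
  weightTerm-mono i with lookup A i in i∈A | lookup B i in i∈B
  ... | true  | true  = ≤-refl
  ... | true  | false with () ← trans (sym ([]=⇒lookup (A⊆B (lookup⇒[]= i A i∈A)))) i∈B
  ... | false | true  = w≥0 i
  ... | false | false = ≤-refl

weight-split : ∀ {n} (w : Fin n → ℚ) (A G : Subset n) → weight w A ≡ weight w (A ∩ ∁ G) + weight w (A ∩ G)
weight-split w A G =
  trans (cong (weight w) (p≡p∩∁q∪p∩q A G)) (weight-∪ w (A ∩ ∁ G) (A ∩ G) (p∩∁q-disjoint-p∩q A G))

_∪ᶜ_ : ∀ {n T} → Chain n T → Chain n T → Chain n T
(A ∪ᶜ B) t = A t ∪ B t

restrict-isChain : ∀ {n T} {S : Chain n T} (X : Subset n) → IsChain S → IsChain (restrict S X)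
restrict-isChain {S = S} X S-chain s t s≤t x∈ =
  let x∈Sₛ , x∈X = x∈p∩q⁻ (S s) X x∈ in x∈p∩q⁺ (S-chain s t s≤t x∈Sₛ , x∈X)

∪ᶜ-isChain : ∀ {n T} {A B : Chain n T} → IsChain A → IsChain B → IsChain (A ∪ᶜ B)
∪ᶜ-isChain {A = A} {B} A-chain B-chain s t s≤t =
  x∈p∪q⁺ ∘ Sum.map (A-chain s t s≤t) (B-chain s t s≤t) ∘ x∈p∪q⁻ (A s) (B s)

prev-⊆ : ∀ {n T} {S : Chain n T} → IsChain S → ∀ t → prev S t ⊆ S t
prev-⊆ S-chain zero    = ⊥⊆
prev-⊆ S-chain (suc t) = S-chain (inject₁ t) (suc t) (i≤inject₁[j]⇒i≤1+j Finₚ.≤-refl)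

prev-cong : ∀ {n T} {S S′ : Chain n T} → (∀ t → S t ≡ S′ t) → ∀ t → prev S t ≡ prev S′ t
prev-cong S≗S′ zero    = refl
prev-cong S≗S′ (suc t) = S≗S′ (inject₁ t)

prev-∪ᶜ : ∀ {n T} (A B : Chain n T) t → prev (A ∪ᶜ B) t ≡ prev A t ∪ prev B t
prev-∪ᶜ A B zero    = sym (∪-identityʳ ⊥)
prev-∪ᶜ A B (suc t) = refl

-- profit p S is definitionally Σ_t weight (λ i → p i t) (S t ─ prev S t).
profit-cong : ∀ {n T} (p : Fin n → Fin T → ℚ) {S S′ : Chain n T} → (∀ t → S t ≡ S′ t)
            → profit p S ≡ profit p S′
profit-cong p S≗S′ = sumF-cong λ t →
  cong₂ (λ X Y → weight (λ i → p i t) (X ─ Y)) (S≗S′ t) (prev-cong S≗S′ t)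

profit-∪ᶜ : ∀ {n T} (p : Fin n → Fin T → ℚ) {A B : Chain n T} → IsChain A → IsChain B
          → (∀ t → Disjoint (A t) (B t)) → profit p (A ∪ᶜ B) ≡ profit p A + profit p B
profit-∪ᶜ p {A} {B} A-chain B-chain A⊥B =
  trans (sumF-cong entering-∪) (sumF-+ (entering A) (entering B))
  where
  entering : Chain _ _ → Fin _ → ℚ
  entering S t = weight (λ i → p i t) (S t ─ prev S t)
  entering-∪ : ∀ t → entering (A ∪ᶜ B) t ≡ entering A t + entering B t
  entering-∪ t = begin
    weight (λ i → p i t) ((A t ∪ B t) ─ prev (A ∪ᶜ B) t)
      ≡⟨ cong (λ X → weight (λ i → p i t) ((A t ∪ B t) ─ X)) (prev-∪ᶜ A B t) ⟩
    weight (λ i → p i t) ((A t ∪ B t) ─ (prev A t ∪ prev B t))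
      ≡⟨ cong (weight (λ i → p i t))
              (∪─∪≡─∪─ (A t) (prev A t) (B t) (prev B t) (prev-⊆ A-chain t) (prev-⊆ B-chain t) (A⊥B t)) ⟩
    weight (λ i → p i t) ((A t ─ prev A t) ∪ (B t ─ prev B t))
      ≡⟨ weight-∪ (λ i → p i t) (A t ─ prev A t) (B t ─ prev B t)
                  (Disjoint-anti-mono (p─q⊆p (A t) (prev A t)) (p─q⊆p (B t) (prev B t)) (A⊥B t)) ⟩
    entering A t + entering B t ∎
    where open ≡-Reasoning

profit-split : ∀ {n T} (p : Fin n → Fin T → ℚ) {S : Chain n T} → IsChain S → (G : Subset n)
             → profit p S ≡ profit p (restrict S (∁ G)) + profit p (restrict S G)
profit-split p {S} S-chain G =
  trans (profit-cong p (λ t → p≡p∩∁q∪p∩q (S t) G))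
        (profit-∪ᶜ p (restrict-isChain (∁ G) S-chain) (restrict-isChain G S-chain)
                     (λ t → p∩∁q-disjoint-p∩q (S t) G))

p≡q+r⇒p-r≡q : ∀ {p q r : ℚ} → p ≡ q + r → p - r ≡ q
p≡q+r⇒p-r≡q {q = q} {r} refl = //-rightDividesʳ r q

+-cancelʳ-≤ : ∀ r {p q : ℚ} → p + r ≤ q + r → p ≤ q
+-cancelʳ-≤ r {p} {q} p+r≤q+r =
  subst₂ _≤_ (//-rightDividesʳ r p) (//-rightDividesʳ r q) (+-monoˡ-≤ (- r) p+r≤q+r)

sufMin-≤ : ∀ {T} (f : Fin T → ℚ) (t : Fin T) → sufMin f t ≤ f t
sufMin-≤ {suc zero}    f zero    = ≤-refl
sufMin-≤ {suc (suc m)} f zero    = p⊓q≤p _ _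
sufMin-≤ {suc (suc m)} f (suc t) = sufMin-≤ (f ∘ suc) t

sufMin-glb : ∀ {T} (f : Fin T → ℚ) (t : Fin T) {x} → (∀ τ → t F.≤ τ → x ≤ f τ) → x ≤ sufMin f t
sufMin-glb {suc zero}    f zero    x≤f = x≤f zero z≤n
sufMin-glb {suc (suc m)} f zero    x≤f = ⊓-glb (x≤f zero z≤n) (sufMin-glb (f ∘ suc) zero λ τ _ → x≤f (suc τ) z≤n)
sufMin-glb {suc (suc m)} f (suc t) x≤f = sufMin-glb (f ∘ suc) t λ τ t≤τ → x≤f (suc τ) (s≤s t≤τ)

lastSet-⊆ : ∀ {n T} (G : Chain n T) (N : Subset n) → lastSet G N ⊆ N
lastSet-⊆ {T = zero}  G N x∈N = x∈N
lastSet-⊆ {T = suc m} G N     = p─q⊆p N (G (fromℕ m))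

lastSet-disjoint : ∀ {n T} {G : Chain n T} (N : Subset n) → IsChain G → ∀ t → Disjoint (lastSet G N) (G t)
lastSet-disjoint {T = suc m} {G} N G-chain t x∈ x∈Gₜ =
  x∈p─q⇒x∉q N (G (fromℕ m)) x∈ (G-chain t (fromℕ m) (≤fromℕ t) x∈Gₜ)

restrict-∁-⊆-lastSet : ∀ {n T} (S : Chain n T) {N : Subset n} (G : Subset n) → (∀ t → S t ⊆ N)
                     → ∀ t → S t ∩ ∁ G ⊆ lastSet (restrict S G) N
restrict-∁-⊆-lastSet {T = suc m} S G S⊆N t x∈ =
  let x∈Sₜ , x∈∁G = x∈p∩q⁻ (S t) (∁ G) x∈
  in x∈p∧x∉q⇒x∈p─q (S⊆N t x∈Sₜ) (x∈∁p⇒x∉p x∈∁G ∘ proj₂ ∘ x∈p∩q⁻ (S (fromℕ m)) G)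

module _ {n T : ℕ} (w : Fin n → ℚ) (I : Instance n T) {S : Chain n T} (S-feasible : Feasible w I S)
         (G : Subset n) where

  private
    S-chain = proj₁ S-feasible
    G-chain = restrict-isChain G S-chain

  residual-feasible : (∀ i → 0ℚ ≤ w i) → Feasible w (residual w I (restrict S G)) (restrict S (∁ G))
  residual-feasible w≥0 =
    restrict-isChain (∁ G) S-chain , restrict-∁-⊆-lastSet S G (proj₁ (proj₂ S-feasible)) , fits
    where
    open ≤-Reasoning
    fits : ∀ t → weight w (S t ∩ ∁ G) ≤ sufMin (λ τ → cap I τ - weight w (S τ ∩ G)) t
    fits t = sufMin-glb _ t λ τ t≤τ → begin
      weight w (S t ∩ ∁ G)                ≤⟨ weight-mono w w≥0 (restrict-isChain (∁ G) S-chain t τ t≤τ) ⟩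
      weight w (S τ ∩ ∁ G)                ≡⟨ p≡q+r⇒p-r≡q (weight-split w (S τ) G) ⟨
      weight w (S τ) - weight w (S τ ∩ G) ≤⟨ +-monoˡ-≤ (- weight w (S τ ∩ G)) (proj₂ (proj₂ S-feasible) τ) ⟩
      cap I τ - weight w (S τ ∩ G)        ∎

  module _ {S′ : Chain n T} (S′-feasible : Feasible w (residual w I (restrict S G)) S′) where

    residual-disjoint : ∀ t → Disjoint (S′ t) (S t ∩ G)
    residual-disjoint t = lastSet-disjoint (items I) G-chain t ∘ proj₁ (proj₂ S′-feasible) t

    residual-extension-feasible : G ⊆ items I → Feasible w I (S′ ∪ᶜ restrict S G)
    residual-extension-feasible G⊆N = ∪ᶜ-isChain (proj₁ S′-feasible) G-chain , ⊆N , fits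
      where
      open ≤-Reasoning
      ⊆N : ∀ t → S′ t ∪ (S t ∩ G) ⊆ items I
      ⊆N t = Sum.[ lastSet-⊆ (restrict S G) (items I) ∘ proj₁ (proj₂ S′-feasible) t , G⊆N ∘ p∩q⊆q (S t) G ]
           ∘ x∈p∪q⁻ (S′ t) (S t ∩ G)
      fits : ∀ t → weight w (S′ t ∪ (S t ∩ G)) ≤ cap I t
      fits t = begin
        weight w (S′ t ∪ (S t ∩ G))                       ≡⟨ weight-∪ w (S′ t) (S t ∩ G) (residual-disjoint t) ⟩
        weight w (S′ t) + weight w (S t ∩ G)              ≤⟨ +-monoˡ-≤ (weight w (S t ∩ G))
                                                               (≤-trans (proj₂ (proj₂ S′-feasible) t) (sufMin-≤ _ t)) ⟩
        cap I t - weight w (S t ∩ G) + weight w (S t ∩ G) ≡⟨ //-rightDividesˡ (weight w (S t ∩ G)) (cap I t) ⟩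
        cap I t                                           ∎

residual-optimal : ∀ {n T} (w : Fin n → ℚ) (p : Fin n → Fin T → ℚ) (I : Instance n T) → (∀ i → 0ℚ ≤ w i)
                 → {S : Chain n T} → Optimal w p I S → (G : Subset n) → G ⊆ items I
                 → Optimal w p (residual w I (restrict S G)) (restrict S (∁ G))
residual-optimal w p I w≥0 {S} (S-feasible , S-best) G G⊆N =
  residual-feasible w I S-feasible G w≥0 , λ S′ S′-feasible → +-cancelʳ-≤ (profit p (restrict S G)) (begin
    profit p S′ + profit p (restrict S G)
      ≡⟨ profit-∪ᶜ p (proj₁ S′-feasible) (restrict-isChain G S-chain)
                     (residual-disjoint w I S-feasible G S′-feasible) ⟨
    profit p (S′ ∪ᶜ restrict S G)
      ≤⟨ S-best _ (residual-extension-feasible w I S-feasible G S′-feasible G⊆N) ⟩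
    profit p S
      ≡⟨ profit-split p S-chain G ⟩
    profit p (restrict S (∁ G)) + profit p (restrict S G) ∎)
  where
  open ≤-Reasoning
  S-chain = proj₁ S-feasible

lemma9 : {n T : ℕ} (w : Fin n → ℚ) (p : Fin n → Fin T → ℚ) (I : Instance n T)
         → ((i : Fin n) → 0ℚ < w i)
         → ((i : Fin n) (t : Fin T) → 0ℚ ≤ p i t)
         → MonotoneCap (cap I)
         → (S : Chain n T) → Feasible w I S
         → (G : Subset n) → G ⊆ items I
         → Feasible w (residual w I (restrict S G)) (restrict S (∁ G))
           × profit p (restrict S (∁ G)) ≡ profit p S - profit p (restrict S G)
           × (Optimal w p I S → Optimal w p (residual w I (restrict S G)) (restrict S (∁ G)))
lemma9 w p I w>0 _ _ S S-feasible G G⊆N =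
    residual-feasible w I S-feasible G w≥0
  , sym (p≡q+r⇒p-r≡q (profit-split p (proj₁ S-feasible) G))
  , λ S-optimal → residual-optimal w p I w≥0 S-optimal G G⊆N
  where
  w≥0 : ∀ i → 0ℚ ≤ w i
  w≥0 = <⇒≤ ∘ w>0
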